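{- For all $d,q\in\mathbb{N}$, the VC-dimension of the edge relation in the Hamming graph $H(d,q)$ is at most $3$.
   Context: For $d,q\in\mathbb{N}$ and a set $S$ with $|S|=q$, the Hamming graph $H(d,q)$ has vertex set $S^d$, two vertices being adjacent iff they agree in all but exactly one coordinate. For a graph $G$, $N(v)$ denotes the open neighbourhood of $v$. A set $A\subseteq V(G)$ is shattered by the edge relation if $\{A\cap N(v):v\in V(G)\}$ is the full power set of $A$; the VC-dimension of the edge relation on $G$ is the supremum of sizes of shattered sets. -}

module Defs where

open import Data.Nat using (ℕ; _≤_)
open import Data.Fin using (Fin)
open import Data.Bool using (Bool; true)
open import Data.Product using (Σ; ∃; _×_)
open import Data.Empty using (⊥)
open import Relation.Nullary using (¬_)
open import Relation.Binary.PropositionalEquality using (_≡_; _≢_)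
open import Function.Bundles using (_⇔_)
open import Function.Definitions using (Injective)

HVertex : ℕ → ℕ → Set
HVertex d q = Fin d → Fin q

HAdj : {d q : ℕ} → HVertex d q → HVertex d q → Set
HAdj {d} x y = Σ (Fin d) λ i → (x i ≢ y i) × ((j : Fin d) → j ≢ i → x j ≡ y j)

InN : {d q : ℕ} → HVertex d q → HVertex d q → Set
InN v a = HAdj v a

-- A set A of n distinct vertices (an injective family indexed by Fin n) is
-- shattered by the edge relation if every subset B ⊆ A (given by its
-- characteristic function) equals A ∩ N(v) for some vertex v.
Shattered : {d q n : ℕ} → (Fin n → HVertex d q) → Set
Shattered {d} {q} {n} A =
  (B : Fin n → Bool) →
  ∃ λ (v : HVertex d q) → (k : Fin n) → (InN v (A k) ⇔ (B k ≡ true))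

VCDimAtMost : ℕ → ℕ → ℕ → Set
VCDimAtMost d q m =
  (n : ℕ) (A : Fin n → HVertex d q) → Injective _≡_ _≡_ A → Shattered A → n ≤ m

-- If {a₀,a₁,a₂,a₃} is shattered, the vertex v realising the whole set is adjacent to
-- every aₖ, so aₖ differs from v in a single coordinate iₖ.  Two neighbours of v in
-- directions i ≠ j span a square and have just one common neighbour besides v, the
-- opposite corner; hence three neighbours of v with a further common neighbour lie on
-- one line through v.  The vertices realising {a₀,a₁,a₂} and {a₁,a₂,a₃} thus put all
-- four points on one line.  But a vertex adjacent to a₀ and a₁ then lies on that line
-- as well, and so is adjacent to all of its points except possibly one.
module Submission where

open import Defs
open import Data.Nat using (ℕ; zero; suc; _+_; z≤n; s≤s)
open import Data.Fin using (Fin; zero; suc)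
open import Data.Fin.Properties using (_≟_)
open import Data.Bool using (Bool; true; false)
open import Data.Product using (_×_; _,_; proj₁; proj₂)
open import Data.Empty using (⊥-elim)
open import Relation.Nullary using (¬_; yes; no; does)
open import Relation.Nullary.Decidable using (dec-true; dec-false)
open import Relation.Binary.PropositionalEquality
  using (_≡_; _≢_; _≗_; refl; sym; trans; ≢-sym)
open import Function.Bundles using (Equivalence)

module _ {d q : ℕ} where

  private
    V : Set
    V = HVertex d q

  AgreeOff : Fin d → V → V → Set
  AgreeOff i x y = (j : Fin d) → j ≢ i → x j ≡ y j

  AdjAt : Fin d → V → V → Set
  AdjAt i x y = x i ≢ y i × AgreeOff i x y

  agreeOff-sym : ∀ {i x y} → AgreeOff i x y → AgreeOff i y x
  agreeOff-sym x~y j j≢i = sym (x~y j j≢i)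

  agreeOff-trans : ∀ {i x y z} → AgreeOff i x y → AgreeOff i y z → AgreeOff i x z
  agreeOff-trans x~y y~z j j≢i = trans (x~y j j≢i) (y~z j j≢i)

  agreeOff⇒≗ : ∀ {i x y} → AgreeOff i x y → x i ≡ y i → x ≗ y
  agreeOff⇒≗ {i} x~y xᵢ≡yᵢ j with j ≟ i
  ... | yes refl = xᵢ≡yᵢ
  ... | no j≢i = x~y j j≢i

  differ⇒direction : ∀ {i j x y} → x i ≢ y i → AgreeOff j x y → i ≡ j
  differ⇒direction {i} {j} xᵢ≢yᵢ x~y with i ≟ j
  ... | yes i≡j = i≡j
  ... | no i≢j = ⊥-elim (xᵢ≢yᵢ (x~y i i≢j))

  neighbours-≗ : ∀ {i v b c} → AdjAt i v b → AdjAt i v c → b i ≡ c i → b ≗ c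
  neighbours-≗ (_ , v~b) (_ , v~c) =
    agreeOff⇒≗ (agreeOff-trans (agreeOff-sym v~b) v~c)

  HAdj-respˡ : ∀ {x y z : V} → x ≗ y → HAdj y z → HAdj x z
  HAdj-respˡ x≗y (i , yᵢ≢zᵢ , y~z) =
    i , (λ xᵢ≡zᵢ → yᵢ≢zᵢ (trans (sym (x≗y i)) xᵢ≡zᵢ)) , λ j j≢i → trans (x≗y j) (y~z j j≢i)

  HAdj-respʳ : ∀ {x y z : V} → y ≗ z → HAdj x y → HAdj x z
  HAdj-respʳ y≗z (i , xᵢ≢yᵢ , x~y) =
    i , (λ xᵢ≡zᵢ → xᵢ≢yᵢ (trans xᵢ≡zᵢ (sym (y≗z i)))) , λ j j≢i → trans (x~y j j≢i) (y≗z j)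

  module Square {i j k l : Fin d} {v a b w : V}
                (v∼a : AdjAt i v a) (v∼b : AdjAt j v b) (i≢j : i ≢ j)
                (w∼a : AdjAt k w a) (w∼b : AdjAt l w b) where

    square-away : ¬ w ≗ v → k ≢ i
    square-away w≉v refl = w≉v (agreeOff⇒≗ w~v wᵢ≡vᵢ)
      where
      w~v : AgreeOff i w v
      w~v = agreeOff-trans (proj₂ w∼a) (agreeOff-sym (proj₂ v∼a))
      j≡l : j ≡ l
      j≡l = differ⇒direction (λ wⱼ≡bⱼ → proj₁ v∼b (trans (sym (w~v j (≢-sym i≢j))) wⱼ≡bⱼ))
                             (proj₂ w∼b)
      wᵢ≡vᵢ : w i ≡ v i
      wᵢ≡vᵢ = trans (proj₂ w∼b i (λ i≡l → i≢j (trans i≡l (sym j≡l)))) (sym (proj₂ v∼b i i≢j))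

    square-cross : k ≢ i → i ≡ l
    square-cross k≢i = differ⇒direction wᵢ≢bᵢ (proj₂ w∼b)
      where
      wᵢ≢bᵢ : w i ≢ b i
      wᵢ≢bᵢ wᵢ≡bᵢ = proj₁ v∼a (trans (proj₂ v∼b i i≢j) (trans (sym wᵢ≡bᵢ) (proj₂ w∼a i (≢-sym k≢i))))

    square-direction : ¬ w ≗ v → i ≡ l
    square-direction w≉v = square-cross (square-away w≉v)

  square-opposite-corner :
    ∀ {i j k l v a b w} → AdjAt i v a → AdjAt j v b → i ≢ j →
    AdjAt k w a → AdjAt l w b → ¬ w ≗ v → k ≡ j × w j ≡ b j
  square-opposite-corner v∼a v∼b i≢j w∼a w∼b w≉v =
    sym (Square.square-direction v∼b v∼a (≢-sym i≢j) w∼b w∼a w≉v) ,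
    proj₂ w∼b _ (λ j≡l → i≢j (trans (Square.square-direction v∼a v∼b i≢j w∼a w∼b w≉v) (sym j≡l)))

  two-squares⇒≗ :
    ∀ {i j j′ v a b c w} → AdjAt i v a → AdjAt j v b → AdjAt j′ v c → i ≢ j → i ≢ j′ →
    HAdj w a → HAdj w b → HAdj w c → ¬ w ≗ v → b ≗ c
  two-squares⇒≗ v∼a v∼b v∼c i≢j i≢j′ (_ , w∼a) (_ , w∼b) (_ , w∼c) w≉v
    with square-opposite-corner v∼a v∼b i≢j w∼a w∼b w≉v
       | square-opposite-corner v∼a v∼c i≢j′ w∼a w∼c w≉v
  ... | refl , wⱼ≡bⱼ | refl , wⱼ≡cⱼ = neighbours-≗ v∼b v∼c (trans (sym wⱼ≡bⱼ) wⱼ≡cⱼ)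

  common-neighbour⇒collinear :
    ∀ {i j k v a b c w} → AdjAt i v a → AdjAt j v b → AdjAt k v c →
    HAdj w a → HAdj w b → HAdj w c → ¬ w ≗ v → ¬ a ≗ c → ¬ b ≗ c → AdjAt i v b
  common-neighbour⇒collinear {i} {j} {k} v∼a v∼b v∼c w∼a w∼b w∼c w≉v a≉c b≉c
    with i ≟ j | k ≟ i
  ... | yes refl | _ = v∼b
  ... | no i≢j | no k≢i =
    ⊥-elim (b≉c (two-squares⇒≗ v∼a v∼b v∼c i≢j (≢-sym k≢i) w∼a w∼b w∼c w≉v))
  ... | no i≢j | yes refl =
    ⊥-elim (a≉c (two-squares⇒≗ v∼b v∼a v∼c (≢-sym i≢j) (≢-sym i≢j) w∼b w∼a w∼c w≉v))

  common-neighbour-on-line :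
    ∀ {i v a b w} → AdjAt i v a → AdjAt i v b → ¬ a ≗ b →
    HAdj w a → HAdj w b → AgreeOff i w v
  common-neighbour-on-line {i} {v} {a} {b} {w} v∼a v∼b a≉b (k , w∼a) (l , w∼b) with k ≟ i
  ... | yes refl = agreeOff-trans (proj₂ w∼a) (agreeOff-sym (proj₂ v∼a))
  ... | no k≢i =
    ⊥-elim (proj₁ w∼a (trans (proj₂ w∼b k k≢l) (trans (sym (proj₂ v∼b k k≢i)) (proj₂ v∼a k k≢i))))
    where
    aᵢ≢bᵢ : a i ≢ b i
    aᵢ≢bᵢ aᵢ≡bᵢ = a≉b (neighbours-≗ v∼a v∼b aᵢ≡bᵢ)
    i≡l : i ≡ l
    i≡l = differ⇒direction (λ wᵢ≡bᵢ → aᵢ≢bᵢ (trans (sym (proj₂ w∼a i (≢-sym k≢i))) wᵢ≡bᵢ))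
                           (proj₂ w∼b)
    k≢l : k ≢ l
    k≢l k≡l = k≢i (trans k≡l (sym i≡l))

  adjacent-along-line :
    ∀ {i v c e w} → AgreeOff i w v → AdjAt i v c → AdjAt i v e → ¬ c ≗ e →
    ¬ HAdj w c → HAdj w e
  adjacent-along-line {i} {w = w} w~v v∼c v∼e c≉e w≁c with w i ≟ _
  ... | no wᵢ≢cᵢ = ⊥-elim (w≁c (i , wᵢ≢cᵢ , agreeOff-trans w~v (proj₂ v∼c)))
  ... | yes wᵢ≡cᵢ =
    i , (λ wᵢ≡eᵢ → c≉e (neighbours-≗ v∼c v∼e (trans (sym wᵢ≡cᵢ) wᵢ≡eᵢ))) ,
    agreeOff-trans w~v (proj₂ v∼e)

  module _ {n : ℕ} {A : Fin n → V} (sh : Shattered A) (B : Fin n → Bool) where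

    separator : V
    separator = proj₁ (sh B)

    separator-adjacent : ∀ k → B k ≡ true → HAdj separator (A k)
    separator-adjacent k = Equivalence.from (proj₂ (sh B) k)

    separator-nonadjacent : ∀ k → B k ≡ false → ¬ HAdj separator (A k)
    separator-nonadjacent k Bₖ≡false s∼Aₖ
      with trans (sym Bₖ≡false) (Equivalence.to (proj₂ (sh B) k) s∼Aₖ)
    ... | ()

    separator-≉ : ∀ {v} k → B k ≡ false → HAdj v (A k) → ¬ separator ≗ v
    separator-≉ k Bₖ≡false v∼Aₖ s≗v = separator-nonadjacent k Bₖ≡false (HAdj-respˡ s≗v v∼Aₖ)

  shattered⇒distinct : ∀ {n} {A : Fin n → V} → Shattered A → ∀ {j k} → j ≢ k → ¬ A j ≗ A k
  shattered⇒distinct sh {j} {k} j≢k Aⱼ≗Aₖ =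
    separator-nonadjacent sh B k (dec-false (k ≟ j) (≢-sym j≢k))
      (HAdj-respʳ Aⱼ≗Aₖ (separator-adjacent sh B j (dec-true (j ≟ j) refl)))
    where
    B : Fin _ → Bool
    B x = does (x ≟ j)

  no-shattered-quadruple : ∀ m (A : Fin (4 + m) → V) → ¬ Shattered A
  no-shattered-quadruple m A sh =
    separator-nonadjacent sh first-two 3F refl
      (adjacent-along-line w-on-line v∼a₂ v∼a₃ (distinct (λ ()))
        (separator-nonadjacent sh first-two 2F refl))
    where
    0F 1F 2F 3F : Fin (4 + m)
    0F = zero
    1F = suc zero
    2F = suc (suc zero)
    3F = suc (suc (suc zero))

    everything all-but-0 all-but-3 first-two : Fin (4 + m) → Bool
    everything _ = true
    all-but-0 = λ { zero → false ; _ → true }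
    all-but-3 = λ { (suc (suc (suc zero))) → false ; _ → true }
    first-two = λ { zero → true ; (suc zero) → true ; _ → false }

    distinct : ∀ {j k} → j ≢ k → ¬ A j ≗ A k
    distinct = shattered⇒distinct sh

    v : V
    v = separator sh everything

    v∼ : ∀ k → HAdj v (A k)
    v∼ k = separator-adjacent sh everything k refl

    i : Fin d
    i = proj₁ (v∼ 0F)

    v∼a₁ : AdjAt i v (A 1F)
    v∼a₁ = common-neighbour⇒collinear (proj₂ (v∼ 0F)) (proj₂ (v∼ 1F)) (proj₂ (v∼ 2F))
      (separator-adjacent sh all-but-3 0F refl) (separator-adjacent sh all-but-3 1F refl)
      (separator-adjacent sh all-but-3 2F refl)
      (separator-≉ sh all-but-3 3F refl (v∼ 3F)) (distinct (λ ())) (distinct (λ ()))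

    v∼a₂ : AdjAt i v (A 2F)
    v∼a₂ = common-neighbour⇒collinear v∼a₁ (proj₂ (v∼ 2F)) (proj₂ (v∼ 3F))
      (separator-adjacent sh all-but-0 1F refl) (separator-adjacent sh all-but-0 2F refl)
      (separator-adjacent sh all-but-0 3F refl)
      (separator-≉ sh all-but-0 0F refl (v∼ 0F)) (distinct (λ ())) (distinct (λ ()))

    v∼a₃ : AdjAt i v (A 3F)
    v∼a₃ = common-neighbour⇒collinear v∼a₂ (proj₂ (v∼ 3F)) v∼a₁
      (separator-adjacent sh all-but-0 2F refl) (separator-adjacent sh all-but-0 3F refl)
      (separator-adjacent sh all-but-0 1F refl)
      (separator-≉ sh all-but-0 0F refl (v∼ 0F)) (distinct (λ ())) (distinct (λ ()))

    w-on-line : AgreeOff i (separator sh first-two) v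
    w-on-line = common-neighbour-on-line (proj₂ (v∼ 0F)) v∼a₁ (distinct (λ ()))
      (separator-adjacent sh first-two 0F refl) (separator-adjacent sh first-two 1F refl)

mainTheorem4 : (d q : ℕ) → VCDimAtMost d q 3
mainTheorem4 d q zero _ _ _ = z≤n
mainTheorem4 d q (suc zero) _ _ _ = s≤s z≤n
mainTheorem4 d q (suc (suc zero)) _ _ _ = s≤s (s≤s z≤n)
mainTheorem4 d q (suc (suc (suc zero))) _ _ _ = s≤s (s≤s (s≤s z≤n))
mainTheorem4 d q (suc (suc (suc (suc m)))) A _ sh = ⊥-elim (no-shattered-quadruple m A sh)
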